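{- For every nonempty $A\subseteq\{0,1\}^m$, ${\rm ETD}(A)\ge {\rm DEN}(A)-1$.
   Context: For $h\in\{0,1\}^m$, a set $S\subseteq[m]$ is a specifying set for $h$ with respect to $A$ if at most one $a\in A$ satisfies $a_i=h_i$ for all $i\in S$; ${\rm ETD}(A,h)$ is the minimum size of such a set and ${\rm ETD}(A)=\max_{h\in\{0,1\}^m}{\rm ETD}(A,h)$. For $B\subseteq\{0,1\}^m$, $j\in[m]$, $\xi\in\{0,1\}$ let $B_{j,\xi}=\{b\in B\mid b_j=\xi\}$ and ${\rm MAMI}(B)=\max_{j\in[m]}\min(|B_{j,0}|,|B_{j,1}|)$. The density is ${\rm DEN}(A)=\max_{B\subseteq A}\frac{|B|-1}{{\rm MAMI}(B)}$ (subsets $B$ with $|B|\le 1$, for which ${\rm MAMI}(B)=0$, are understood to contribute $0$). -}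

module Defs where

open import Data.Bool using (Bool; true; false; if_then_else_; _∧_; not)
open import Data.Bool.Properties using () renaming (_≟_ to _≟ᵇ_)
open import Data.Nat using (ℕ; zero; suc; _⊓_; _⊔_; _≤ᵇ_)
open import Data.Fin using (Fin)
open import Data.Vec using (Vec; []; _∷_; lookup; count)
open import Data.List using (List; []; _∷_; map; foldr; length; filterᵇ; concatMap)
open import Data.List using () renaming (allFin to allFinL)
open import Data.Rational using (ℚ; _/_; 0ℚ) renaming (_⊔_ to _⊔ℚ_)
open import Data.Integer using (+_)
open import Relation.Nullary.Decidable using (does)

-- {0,1}^m is represented by Vec Bool m (false = 0, true = 1).
-- A subset S ⊆ [m] is represented by its characteristic vector Vec Bool m.

allVecs : (m : ℕ) → List (Vec Bool m)
allVecs zero = [] ∷ []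
allVecs (suc m) = concatMap (λ v → (false ∷ v) ∷ (true ∷ v) ∷ []) (allVecs m)

-- all sublists of a list (for a duplicate-free list: all subsets)
sublists : {X : Set} → List X → List (List X)
sublists [] = [] ∷ []
sublists (x ∷ xs) = sublists xs Data.List.++ map (x ∷_) (sublists xs)

_==_ : Bool → Bool → Bool
x == y = does (x ≟ᵇ y)

size : {m : ℕ} → Vec Bool m → ℕ
size S = count (λ b → b ≟ᵇ true) S

agreeOn : {m : ℕ} → Vec Bool m → Vec Bool m → Vec Bool m → Bool
agreeOn [] [] [] = true
agreeOn (s ∷ S) (a ∷ as) (h ∷ hs) = (if s then a == h else true) ∧ agreeOn S as hs

isSpecifying : {m : ℕ} → List (Vec Bool m) → Vec Bool m → Vec Bool m → Bool
isSpecifying A h S = length (filterᵇ (λ a → agreeOn S a h) A) ≤ᵇ 1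

-- ETD(A,h): minimum size of a specifying set
-- (the full set [m] is always specifying for duplicate-free A, so m is a safe start value)
ETDh : {m : ℕ} → List (Vec Bool m) → Vec Bool m → ℕ
ETDh {m} A h = foldr _⊓_ m (map size (filterᵇ (isSpecifying A h) (allVecs m)))

ETD : {m : ℕ} → List (Vec Bool m) → ℕ
ETD {m} A = foldr _⊔_ 0 (map (ETDh A) (allVecs m))

countAt : {m : ℕ} → List (Vec Bool m) → Fin m → Bool → ℕ
countAt B j ξ = length (filterᵇ (λ b → lookup b j == ξ) B)

MAMI : {m : ℕ} → List (Vec Bool m) → ℕ
MAMI {m} B = foldr _⊔_ 0 (map (λ j → countAt B j false ⊓ countAt B j true) (allFinL m))

-- (|B|-1)/MAMI(B), taken to be 0 when MAMI(B) = 0 (which happens exactly when |B| ≤ 1)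
ratio : {m : ℕ} → List (Vec Bool m) → ℚ
ratio B with MAMI B
... | zero = 0ℚ
... | suc k = + (length B Data.Nat.∸ 1) / suc k

-- DEN(A) = max over B ⊆ A of ratio(B)  (all ratios are ≥ 0, so 0 is a safe start value)
DEN : {m : ℕ} → List (Vec Bool m) → ℚ
DEN A = foldr _⊔ℚ_ 0ℚ (map ratio (sublists A))

module Submission where

-- For B ⊆ A let h be the coordinatewise majority vote of B and S a smallest specifying set
-- for h with respect to A, so |S| ≤ ETD(A). At most one b ∈ B agrees with h on S; every
-- other b disagrees with h at some i ∈ S, and at each coordinate i only the minority,
-- min(|B_{i,0}|, |B_{i,1}|) ≤ MAMI(B) elements, disagree with the majority. Hence
-- |B| - 1 ≤ ETD(A) · MAMI(B), i.e. DEN(A) ≤ ETD(A), which is stronger than the claim.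

open import Defs
open import Data.Bool using (Bool; true; false; not; T)
open import Data.Empty using (⊥-elim)
open import Data.Fin using (Fin; zero; suc)
open import Data.Integer as ℤ using (+_)
import Data.Integer.Properties as ℤ
open import Data.List using (List; []; _∷_; map; foldr; length; filterᵇ)
open import Data.List.Properties using (length-map)
open import Data.List.Membership.Propositional using (_∈_)
open import Data.List.Membership.Propositional.Properties using (∈-++⁻; ∈-map⁻; ∈-allFin; ∈-filter⁻; ∈-concatMap⁺)
open import Data.List.Relation.Unary.All as All using (All; []; _∷_)
open import Data.List.Relation.Unary.All.Properties using (all-filter; map⁺)
open import Data.List.Relation.Unary.Any as Any using (here; there)
open import Data.List.Relation.Unary.AllPairs using (_∷_)
open import Data.List.Relation.Unary.Unique.Propositional using (Unique)
import Data.List.Relation.Unary.Unique.Propositional.Properties as Unique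
open import Data.List.Relation.Binary.Sublist.Propositional using (_⊆_; []; _∷_; _∷ʳ_)
open import Data.List.Relation.Binary.Sublist.Propositional.Properties using (filter⁺; length-mono-≤)
open import Data.Nat.Base as ℕ using (ℕ; zero; suc; _+_; _*_; _∸_; _⊓_; _⊔_; z≤n; s≤s)
import Data.Nat.Properties as ℕ
open import Data.Product using (∃-syntax; _×_; _,_; proj₂)
open import Data.Rational as ℚ using (_≤_; _-_; 1ℚ; _/_; 0ℚ; fromℚᵘ)
import Data.Rational.Properties as ℚ
import Data.Rational.Unnormalised as ℚᵘ
import Data.Rational.Unnormalised.Properties as ℚᵘ
open import Data.Sum using (_⊎_; inj₁; inj₂)
open import Data.Unit using (tt)
open import Data.Vec using (Vec; []; _∷_; lookup; tabulate; replicate; tail)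
open import Data.Vec.Properties using (lookup∘tabulate)
open import Function using (_∘_)
open import Relation.Binary.PropositionalEquality using (_≡_; _≢_; refl; sym; trans; cong; subst)
open import Relation.Nullary.Decidable using (T?)
open import Relation.Nullary.Reflects using (ofʸ; ofⁿ)

≤-foldr-⊔ : ∀ {X : Set} (f : X → ℕ) {x xs} → x ∈ xs → f x ℕ.≤ foldr _⊔_ 0 (map f xs)
≤-foldr-⊔ f {xs = y ∷ _} (here refl) = ℕ.m≤m⊔n (f y) _
≤-foldr-⊔ f {xs = y ∷ _} (there x∈) = ℕ.m≤n⇒m≤o⊔n (f y) (≤-foldr-⊔ f x∈)

foldr-⊓-attained : ∀ {X : Set} (f : X → ℕ) e xs →
  foldr _⊓_ e (map f xs) ≡ e ⊎ ∃[ x ] (x ∈ xs × f x ≡ foldr _⊓_ e (map f xs))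
foldr-⊓-attained f e [] = inj₁ refl
foldr-⊓-attained f e (y ∷ ys) with ℕ.⊓-sel (f y) (foldr _⊓_ e (map f ys))
... | inj₁ min≡fy = inj₂ (y , here refl , sym min≡fy)
... | inj₂ min≡rest with foldr-⊓-attained f e ys
...   | inj₁ rest≡e = inj₁ (trans min≡rest rest≡e)
...   | inj₂ (x , x∈ , fx≡rest) = inj₂ (x , there x∈ , trans fx≡rest (sym min≡rest))

length-filterᵇ-∷-≤ : ∀ {X : Set} (p : X → Bool) y xs →
  length (filterᵇ p (y ∷ xs)) ℕ.≤ suc (length (filterᵇ p xs))
length-filterᵇ-∷-≤ p y xs with p y
... | true = ℕ.≤-refl
... | false = ℕ.n≤1+n _

length-filterᵇ-mono-⊆ : ∀ {X : Set} (p : X → Bool) {xs ys} → xs ⊆ ys →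
  length (filterᵇ p xs) ℕ.≤ length (filterᵇ p ys)
length-filterᵇ-mono-⊆ p xs⊆ys = length-mono-≤ (filter⁺ (T? ∘ p) (T? ∘ p) (λ { refl t → t }) xs⊆ys)

All≡-Unique⇒length≤1 : ∀ {X : Set} {x : X} {xs} → All (_≡ x) xs → Unique xs → length xs ℕ.≤ 1
All≡-Unique⇒length≤1 [] _ = z≤n
All≡-Unique⇒length≤1 (_ ∷ []) _ = s≤s z≤n
All≡-Unique⇒length≤1 (refl ∷ refl ∷ _) ((x≢x ∷ _) ∷ _) = ⊥-elim (x≢x refl)

∈-allVecs : ∀ {m} (v : Vec Bool m) → v ∈ allVecs m
∈-allVecs [] = here refl
∈-allVecs (false ∷ v) = ∈-concatMap⁺ _ (Any.map (λ { refl → here refl }) (∈-allVecs v))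
∈-allVecs (true ∷ v) = ∈-concatMap⁺ _ (Any.map (λ { refl → there (here refl) }) (∈-allVecs v))

∈-sublists⇒⊆ : ∀ {X : Set} (xs : List X) {ys} → ys ∈ sublists xs → ys ⊆ xs
∈-sublists⇒⊆ [] (here refl) = []
∈-sublists⇒⊆ (x ∷ xs) ys∈ with ∈-++⁻ (sublists xs) ys∈
... | inj₁ ys∈′ = x ∷ʳ ∈-sublists⇒⊆ xs ys∈′
... | inj₂ x∷zs∈ with ∈-map⁻ (x ∷_) x∷zs∈
...   | _ , zs∈ , refl = refl ∷ ∈-sublists⇒⊆ xs zs∈

agreeing : ∀ {m} → Vec Bool m → Vec Bool m → List (Vec Bool m) → List (Vec Bool m)
agreeing S h = filterᵇ (λ a → agreeOn S a h)

agreeOn-full⇒≡ : ∀ {m} (a h : Vec Bool m) → T (agreeOn (replicate m true) a h) → a ≡ h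
agreeOn-full⇒≡ [] [] _ = refl
agreeOn-full⇒≡ (false ∷ a) (false ∷ h) agree = cong (false ∷_) (agreeOn-full⇒≡ a h agree)
agreeOn-full⇒≡ (true ∷ a) (true ∷ h) agree = cong (true ∷_) (agreeOn-full⇒≡ a h agree)

size-full : ∀ m → size (replicate m true) ≡ m
size-full zero = refl
size-full (suc m) = cong suc (size-full m)

full-set-specifying : ∀ {m} {A : List (Vec Bool m)} (h : Vec Bool m) → Unique A →
  length (agreeing (replicate m true) h A) ℕ.≤ 1
full-set-specifying {m} {A} h uA = All≡-Unique⇒length≤1
  (All.map (agreeOn-full⇒≡ _ h) (all-filter (T? ∘ λ a → agreeOn (replicate m true) a h) A))
  (Unique.filter⁺ _ uA)

-- ETDh starts its minimum at m; that value is attained by the full set [m], which is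
-- specifying because A has no duplicates.
smallest-specifying-set : ∀ {m} (A : List (Vec Bool m)) (h : Vec Bool m) → Unique A →
  ∃[ S ] (size S ℕ.≤ ETDh A h × length (agreeing S h A) ℕ.≤ 1)
smallest-specifying-set {m} A h uA with foldr-⊓-attained size m (filterᵇ (isSpecifying A h) (allVecs m))
... | inj₁ ETDh≡m =
  replicate m true , ℕ.≤-reflexive (trans (size-full m) (sym ETDh≡m)) , full-set-specifying h uA
... | inj₂ (S , S∈ , |S|≡ETDh) =
  S , ℕ.≤-reflexive |S|≡ETDh
    , ℕ.≤ᵇ⇒≤ _ 1 (proj₂ (∈-filter⁻ (T? ∘ isSpecifying A h) {xs = allVecs m} S∈))

countAt-tail : ∀ {m} (B : List (Vec Bool (suc m))) j ξ → countAt B (suc j) ξ ≡ countAt (map tail B) j ξ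
countAt-tail [] j ξ = refl
countAt-tail ((_ ∷ b) ∷ B) j ξ with lookup b j == ξ
... | true = cong suc (countAt-tail B j ξ)
... | false = countAt-tail B j ξ

disagreements : ∀ {m} → Vec Bool m → Vec Bool m → List (Vec Bool m) → ℕ
disagreements [] [] B = 0
disagreements (false ∷ S) (_ ∷ h) B = disagreements S h (map tail B)
disagreements (true ∷ S) (x ∷ h) B = countAt B zero (not x) + disagreements S h (map tail B)

disagreements≤size* : ∀ {m} (S h : Vec Bool m) B K → (∀ j → countAt B j (not (lookup h j)) ℕ.≤ K) →
  disagreements S h B ℕ.≤ size S * K
disagreements≤size* [] [] B K _ = z≤n
disagreements≤size* (s ∷ S) (x ∷ h) B K bound = step s
  where
    ih : disagreements S h (map tail B) ℕ.≤ size S * K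
    ih = disagreements≤size* S h (map tail B) K (λ j → subst (ℕ._≤ K) (countAt-tail B j _) (bound (suc j)))
    step : ∀ s → disagreements (s ∷ S) (x ∷ h) B ℕ.≤ size (s ∷ S) * K
    step false = ih
    step true = ℕ.+-mono-≤ (bound zero) ih

agreeing-[] : (B : List (Vec Bool 0)) → agreeing [] [] B ≡ B
agreeing-[] [] = refl
agreeing-[] ([] ∷ B) = cong ([] ∷_) (agreeing-[] B)

length-agreeing-unconstrained : ∀ {m} (S h : Vec Bool m) x B →
  length (agreeing (false ∷ S) (x ∷ h) B) ≡ length (agreeing S h (map tail B))
length-agreeing-unconstrained S h x [] = refl
length-agreeing-unconstrained S h x ((_ ∷ b) ∷ B) with agreeOn S b h
... | true = cong suc (length-agreeing-unconstrained S h x B)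
... | false = length-agreeing-unconstrained S h x B

-- An element lost by constraining the first coordinate disagrees with x there.
length-agreeing-constrained : ∀ {m} (S h : Vec Bool m) x B →
  length (agreeing S h (map tail B)) ℕ.≤ length (agreeing (true ∷ S) (x ∷ h) B) + countAt B zero (not x)
length-agreeing-constrained S h x [] = z≤n
length-agreeing-constrained S h false ((false ∷ b) ∷ B) with agreeOn S b h | length-agreeing-constrained S h false B
... | true | ih = s≤s ih
... | false | ih = ih
length-agreeing-constrained S h true ((true ∷ b) ∷ B) with agreeOn S b h | length-agreeing-constrained S h true B
... | true | ih = s≤s ih
... | false | ih = ih
length-agreeing-constrained S h false ((true ∷ b) ∷ B) =
  ℕ.≤-trans (length-filterᵇ-∷-≤ _ b (map tail B))
    (ℕ.≤-trans (s≤s (length-agreeing-constrained S h false B)) (ℕ.≤-reflexive (sym (ℕ.+-suc _ _))))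
length-agreeing-constrained S h true ((false ∷ b) ∷ B) =
  ℕ.≤-trans (length-filterᵇ-∷-≤ _ b (map tail B))
    (ℕ.≤-trans (s≤s (length-agreeing-constrained S h true B)) (ℕ.≤-reflexive (sym (ℕ.+-suc _ _))))

length≤agreeing+disagreements : ∀ {m} (S h : Vec Bool m) B →
  length B ℕ.≤ length (agreeing S h B) + disagreements S h B
length≤agreeing+disagreements [] [] B rewrite agreeing-[] B = ℕ.m≤m+n (length B) 0
length≤agreeing+disagreements (false ∷ S) (x ∷ h) B = begin
  length B                                              ≡⟨ length-map tail B ⟨
  length B′                                             ≤⟨ length≤agreeing+disagreements S h B′ ⟩
  length (agreeing S h B′) + disagreements S h B′       ≡⟨ cong (_+ _) (length-agreeing-unconstrained S h x B) ⟨
  length (agreeing (false ∷ S) (x ∷ h) B) + disagreements (false ∷ S) (x ∷ h) B ∎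
  where
    open ℕ.≤-Reasoning
    B′ = map tail B
length≤agreeing+disagreements (true ∷ S) (x ∷ h) B = begin
  length B                                              ≡⟨ length-map tail B ⟨
  length B′                                             ≤⟨ length≤agreeing+disagreements S h B′ ⟩
  length (agreeing S h B′) + disagreements S h B′       ≤⟨ ℕ.+-monoˡ-≤ _ (length-agreeing-constrained S h x B) ⟩
  kept + countAt B zero (not x) + disagreements S h B′  ≡⟨ ℕ.+-assoc kept (countAt B zero (not x)) _ ⟩
  kept + disagreements (true ∷ S) (x ∷ h) B             ∎
  where
    open ℕ.≤-Reasoning
    B′ = map tail B
    kept = length (agreeing (true ∷ S) (x ∷ h) B)

majority-bit : ∀ {m} → List (Vec Bool m) → Fin m → Bool
majority-bit B j = countAt B j false ℕ.<ᵇ countAt B j true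

majority : ∀ {m} → List (Vec Bool m) → Vec Bool m
majority B = tabulate (majority-bit B)

minority≤⊓ : ∀ {m} (B : List (Vec Bool m)) j →
  countAt B j (not (lookup (majority B) j)) ℕ.≤ countAt B j false ⊓ countAt B j true
minority≤⊓ B j rewrite lookup∘tabulate (majority-bit B) j
  with countAt B j false ℕ.<ᵇ countAt B j true | ℕ.<ᵇ-reflects-< (countAt B j false) (countAt B j true)
... | true | ofʸ false<true = ℕ.⊓-glb ℕ.≤-refl (ℕ.<⇒≤ false<true)
... | false | ofⁿ false≮true = ℕ.⊓-glb (ℕ.≮⇒≥ false≮true) ℕ.≤-refl

minority≤MAMI : ∀ {m} (B : List (Vec Bool m)) j → countAt B j (not (lookup (majority B) j)) ℕ.≤ MAMI B
minority≤MAMI B j =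
  ℕ.≤-trans (minority≤⊓ B j) (≤-foldr-⊔ (λ j → countAt B j false ⊓ countAt B j true) (∈-allFin j))

length∸1≤ETD*MAMI : ∀ {m} {A B : List (Vec Bool m)} → Unique A → B ⊆ A →
  length B ∸ 1 ℕ.≤ ETD A * MAMI B
length∸1≤ETD*MAMI {A = A} {B} uA B⊆A with smallest-specifying-set A (majority B) uA
... | S , |S|≤ETDh , S-specifies = ℕ.∸-monoˡ-≤ 1 (begin
  length B                                        ≤⟨ length≤agreeing+disagreements S h B ⟩
  length (agreeing S h B) + disagreements S h B   ≤⟨ ℕ.+-mono-≤ agreeing≤1 disagreements≤ ⟩
  1 + size S * MAMI B                             ≤⟨ ℕ.+-monoʳ-≤ 1 (ℕ.*-monoˡ-≤ (MAMI B) |S|≤ETD) ⟩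
  1 + ETD A * MAMI B                              ∎)
  where
    open ℕ.≤-Reasoning
    h = majority B
    agreeing≤1 : length (agreeing S h B) ℕ.≤ 1
    agreeing≤1 = ℕ.≤-trans (length-filterᵇ-mono-⊆ _ B⊆A) S-specifies
    disagreements≤ : disagreements S h B ℕ.≤ size S * MAMI B
    disagreements≤ = disagreements≤size* S h B (MAMI B) (minority≤MAMI B)
    |S|≤ETD : size S ℕ.≤ ETD A
    |S|≤ETD = ℕ.≤-trans |S|≤ETDh (≤-foldr-⊔ (ETDh A) (∈-allVecs h))

0≤n/1 : ∀ n → 0ℚ ≤ + n / 1
0≤n/1 n = ℚ.nonNegative⁻¹ _ {{ℚ.normalize-nonNeg n 1}}

fromℚᵘ-mono-≤ : ∀ {p q} → p ℚᵘ.≤ q → fromℚᵘ p ≤ fromℚᵘ q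
fromℚᵘ-mono-≤ {p} {q} p≤q = ℚ.toℚᵘ-cancel-≤
  (ℚᵘ.≤-respˡ-≃ (ℚᵘ.≃-sym (ℚ.toℚᵘ-fromℚᵘ p)) (ℚᵘ.≤-respʳ-≃ (ℚᵘ.≃-sym (ℚ.toℚᵘ-fromℚᵘ q)) p≤q))

ratio≤ : ∀ {m} (B : List (Vec Bool m)) d → length B ∸ 1 ℕ.≤ d * MAMI B → ratio B ≤ + d / 1
ratio≤ B d bound with MAMI B
... | zero = 0≤n/1 d
... | suc k = fromℚᵘ-mono-≤ {ℚᵘ.mkℚᵘ (+ (length B ∸ 1)) k} {ℚᵘ.mkℚᵘ (+ d) 0}
  (ℚᵘ.*≤* (begin
  + (length B ∸ 1) ℤ.* + 1  ≡⟨ ℤ.*-identityʳ _ ⟩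
  + (length B ∸ 1)          ≤⟨ ℤ.+≤+ bound ⟩
  + (d * suc k)             ≡⟨ ℤ.pos-* d (suc k) ⟩
  + d ℤ.* + suc k           ∎))
  where open ℤ.≤-Reasoning

foldr-⊔-≤ : ∀ {q} xs → 0ℚ ≤ q → All (_≤ q) xs → foldr ℚ._⊔_ 0ℚ xs ≤ q
foldr-⊔-≤ [] 0≤q [] = 0≤q
foldr-⊔-≤ (x ∷ xs) 0≤q (x≤q ∷ xs≤q) = ℚ.⊔-lub x≤q (foldr-⊔-≤ xs 0≤q xs≤q)

DEN≤ETD : ∀ {m} {A : List (Vec Bool m)} → Unique A → DEN A ≤ + ETD A / 1
DEN≤ETD {A = A} uA = foldr-⊔-≤ (map ratio (sublists A)) (0≤n/1 (ETD A))
  (map⁺ (All.tabulate λ {B} B∈ → ratio≤ B (ETD A) (length∸1≤ETD*MAMI uA (∈-sublists⇒⊆ A B∈))))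

p-1≤p : ∀ p → p - 1ℚ ≤ p
p-1≤p p = begin
  p - 1ℚ   ≤⟨ ℚ.+-monoʳ-≤ p (ℚ.≤ᵇ⇒≤ tt) ⟩
  p ℚ.+ 0ℚ ≡⟨ ℚ.+-identityʳ p ⟩
  p        ∎
  where open ℚ.≤-Reasoning

lemma6 : (m : ℕ) (A : List (Vec Bool m)) → Unique A → A ≢ [] →
    DEN A - 1ℚ ≤ (+ ETD A) / 1
lemma6 m A uA _ = ℚ.≤-trans (p-1≤p (DEN A)) (DEN≤ETD uA)
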